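{- Let $\sigma$ be a shuffle and $\lambda=\zeta(\sigma)$, and let $\boldsymbol\lambda=(m,1^{n-1})$. (a) With $\beta=\epsilon_n-\delta_1$, we have $\boldsymbol\lambda\subseteq\lambda$ if and only if $-\beta$ is the highest root of $\mathfrak b(\sigma)$. (b) $\lambda_1=m$ if and only if $\sigma(m')=n$. (c) $\boldsymbol\lambda\subseteq\lambda$ if and only if $\sigma(1)=1'$ and $\sigma(m')=n$.
   Context: Fix positive integers $m>n$. $\mathbf R$ is a grid with $n$ rows (indexed top to bottom by $\epsilon_1,\dots,\epsilon_n$) and $m$ columns (left to right by $\delta_1,\dots,\delta_m$). Partitions $\lambda=(\lambda_1\ge\dots\ge\lambda_n\ge0)$ with $\lambda_1\le m$ are drawn with $\lambda_k$ left-justified boxes in row $\epsilon_{n+1-k}$; containment of partitions means containment of diagrams. Let $I=\{1,\dots,n\}\cup\{1',\dots,m'\}$. A shuffle is a permutation $\sigma$ of $I$ whose one-line notation $(\sigma(1),\dots,\sigma(n),\sigma(1'),\dots,\sigma(m'))$ contains $1,\dots,n$ in increasing order and $1',\dots,m'$ in increasing order. $\zeta(\sigma)$ is the partition whose diagram consists of the boxes of $\mathbf R$ below the lattice path from the top-left to the bottom-right corner of $\mathbf R$ whose $k$-th step is down if the $k$-th entry of the one-line notation lies in $\{1,\dots,n\}$ and right otherwise. Writing $\epsilon_{j'}=\delta_j$ and $e_k$ for the $k$-th entry of the one-line notation, $\mathfrak b(\sigma)$ is the Borel subalgebra of $\mathfrak{gl}(n|m)$ containing the diagonal matrices with simple roots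 $\epsilon_{e_k}-\epsilon_{e_{k+1}}$, $k\in[m+n-1]$; its positive roots are $\epsilon_{e_k}-\epsilon_{e_l}$ with $k<l$, and its highest root is $\epsilon_{e_1}-\epsilon_{e_{m+n}}$. -}

module Defs where

open import Data.Nat using (ℕ; zero; suc; _<_; s≤s; z≤n)
open import Data.Fin using (Fin; zero; suc; fromℕ; opposite; _≟_)
open import Data.Sum using (_⊎_; inj₁; inj₂)
open import Data.List using (List; []; _∷_; map; _++_; allFin)
open import Data.Integer using (ℤ; _-_; -_; 0ℤ; 1ℤ)
open import Relation.Binary.PropositionalEquality using (_≡_)
open import Relation.Nullary using (yes; no)
open import Function.Definitions using (Bijective)
open import Function.Base using (_∘_)

-- The index set I = {1,…,n} ∪ {1',…,m'}; inj₁ i is the unprimed index i+1,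
-- inj₂ j is the primed index (j+1)'.
Idx : ℕ → ℕ → Set
Idx n m = Fin n ⊎ Fin m

idxList : (n m : ℕ) → List (Idx n m)
idxList n m = map inj₁ (allFin n) ++ map inj₂ (allFin m)

oneLine : ∀ {n m} → (Idx n m → Idx n m) → List (Idx n m)
oneLine {n} {m} σ = map σ (idxList n m)

unprimed : ∀ {n m} → List (Idx n m) → List (Fin n)
unprimed [] = []
unprimed (inj₁ i ∷ xs) = i ∷ unprimed xs
unprimed (inj₂ _ ∷ xs) = unprimed xs

primed : ∀ {n m} → List (Idx n m) → List (Fin m)
primed [] = []
primed (inj₁ _ ∷ xs) = primed xs
primed (inj₂ j ∷ xs) = j ∷ primed xs

record Shuffle (n m : ℕ) : Set where
  field
    σ          : Idx n m → Idx n m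
    bijective  : Bijective _≡_ _≡_ σ
    unprimedOrd : unprimed (oneLine σ) ≡ allFin n
    primedOrd   : primed (oneLine σ) ≡ allFin m
open Shuffle public

-- Number of primed entries (right steps) of a word strictly before the
-- first occurrence of the unprimed entry i (the down step crossing row ε_i).
rightStepsBefore : ∀ {n m} → Fin n → List (Idx n m) → ℕ
rightStepsBefore i [] = 0
rightStepsBefore i (inj₁ j ∷ xs) with j ≟ i
... | yes _ = 0
... | no  _ = rightStepsBefore i xs
rightStepsBefore i (inj₂ _ ∷ xs) = suc (rightStepsBefore i xs)

-- Partitions with at most n parts, as λ : Fin n → ℕ, λ k = λ_{k+1}.
Partition : ℕ → Set
Partition n = Fin n → ℕ

-- Diagram: box in row ε_{r+1} (r : Fin n, top to bottom) and column δ_{c+1};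
-- row ε_{n+1-k} carries λ_k left-justified boxes.
InDiagram : ∀ {n} → Partition n → Fin n → ℕ → Set
InDiagram {n} λ' r c = c < λ' (opposite r)

_⊆ₚ_ : ∀ {n} → Partition n → Partition n → Set
μ ⊆ₚ λ' = ∀ r c → InDiagram μ r c → InDiagram λ' r c

-- ζ(σ): the boxes below the lattice path in row ε_{r+1} are exactly the
-- first (number of right steps before the r+1-th down step) boxes.
rowLength : ∀ {n m} → Shuffle n m → Fin n → ℕ
rowLength s r = rightStepsBefore r (oneLine (σ s))

ζ : ∀ {n m} → Shuffle n m → Partition n
ζ s k = rowLength s (opposite k)

hook : (n m : ℕ) → Partition n
hook n m zero = m
hook n m (suc _) = 1

-- Weights: ℤ-combinations of ε_i (i ∈ I, with ε_{j'} = δ_j), as functions I → ℤ.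
Weight : ℕ → ℕ → Set
Weight n m = Idx n m → ℤ

ε : ∀ {n m} → Idx n m → Weight n m
ε {n} {m} (inj₁ i) (inj₁ k) with i ≟ k
... | yes _ = 1ℤ
... | no  _ = 0ℤ
ε (inj₁ _) (inj₂ _) = 0ℤ
ε (inj₂ _) (inj₁ _) = 0ℤ
ε (inj₂ j) (inj₂ k) with j ≟ k
... | yes _ = 1ℤ
... | no  _ = 0ℤ

_−ʷ_ : ∀ {n m} → Weight n m → Weight n m → Weight n m
(a −ʷ b) i = a i - b i

negʷ : ∀ {n m} → Weight n m → Weight n m
negʷ a i = - a i

_≗ʷ_ : ∀ {n m} → Weight n m → Weight n m → Set
a ≗ʷ b = ∀ i → a i ≡ b i

firstFin : ∀ {n} → 0 < n → Fin n
firstFin {suc n} _ = zero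

lastFin : ∀ {n} → 0 < n → Fin n
lastFin {suc n} _ = fromℕ n

-- Highest root of 𝔟(σ): ε_{e_1} − ε_{e_{m+n}}, where e_1 = σ(1) and
-- e_{m+n} = σ(m') are the first and last entries of the one-line notation.
highestRoot : ∀ {n m} → 0 < n → 0 < m → Shuffle n m → Weight n m
highestRoot pn pm s = ε (σ s (inj₁ (firstFin pn))) −ʷ ε (σ s (inj₂ (lastFin pm)))

-- Reading the lattice path of a shuffle σ as a word in down steps (unprimed letters) and right
-- steps (primed letters), the row of ε_i in ζ(σ) has as many boxes as there are right steps
-- before the down step i.  The hook (m,1^{n-1}) lies in ζ(σ) iff the row of ε_n is full and
-- every row is nonempty.  The row of ε_n, the last down step, is full iff no right step follows
-- it, i.e. the word ends in n; every row is nonempty iff the word starts with a right step,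
-- i.e. with 1'.  Finally ε_{σ(1)} − ε_{σ(m')} = δ_1 − ε_n determines σ(1) and σ(m').
module Submission where

open import Defs
open import Data.Nat using (ℕ; zero; suc; _<_; _≤_; _+_; s≤s; z≤n)
open import Data.Nat.Properties using (<-trans; ≤-trans; ≤-antisym; ≤-reflexive; n<1+n; <-irrefl; +-comm; module ≤-Reasoning)
open import Data.Fin using (Fin; zero; suc; fromℕ; inject₁; opposite; _≟_)
open import Data.Fin.Properties using (opposite-involutive; fromℕ≢inject₁)
open import Data.Sum using (_⊎_; inj₁; inj₂)
open import Data.Sum.Properties using (≡-dec)
open import Data.Product using (_×_; _,_; ∃)
open import Data.Product.Function.NonDependent.Propositional using (_×-⇔_)
open import Data.List using (List; []; _∷_; _++_; _∷ʳ_; [_]; map; length; tabulate; allFin)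
open import Data.List.Properties using (map-++; ++-assoc; ++-identityʳ; ∷ʳ-injective; length-++; length-tabulate)
open import Data.List.Membership.Propositional using (_∈_; _∉_)
open import Data.List.Membership.Propositional.Properties using (∈-tabulate⁻; ∈-++⁺ʳ)
open import Data.List.Relation.Unary.Any using (here; there)
open import Data.Integer using (ℤ; -_; _-_; 0ℤ; 1ℤ)
import Data.Integer as ℤ
import Data.Integer.Properties as ℤ
open import Data.Empty using (⊥-elim)
open import Function.Base using (_∘_)
open import Function.Bundles using (_⇔_; mk⇔)
open import Function.Construct.Composition using (_⇔-∘_)
open import Function.Construct.Symmetry using (⇔-sym)
open import Relation.Nullary using (yes; no)
open import Relation.Binary.PropositionalEquality using (_≡_; _≢_; refl; sym; trans; cong; cong₂; subst; module ≡-Reasoning)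

tabulate-∷ʳ : ∀ {A : Set} n (f : Fin (suc n) → A) → tabulate f ≡ tabulate (f ∘ inject₁) ∷ʳ f (fromℕ n)
tabulate-∷ʳ zero    f = refl
tabulate-∷ʳ (suc n) f = cong (f zero ∷_) (tabulate-∷ʳ n (f ∘ suc))

allFin-∷ʳ : ∀ n → allFin (suc n) ≡ tabulate inject₁ ∷ʳ fromℕ n
allFin-∷ʳ n = tabulate-∷ʳ n (λ i → i)

fromℕ∉tabulate-inject₁ : ∀ n → fromℕ n ∉ tabulate inject₁
fromℕ∉tabulate-inject₁ n p with ∈-tabulate⁻ p
... | i , eq = fromℕ≢inject₁ eq

neg-minus : ∀ i j → - (i - j) ≡ j - i
neg-minus i j = begin
  - (i - j)       ≡⟨ ℤ.neg-distrib-+ i (- j) ⟩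
  - i ℤ.+ - (- j) ≡⟨ cong (λ k → - i ℤ.+ k) (ℤ.neg-involutive j) ⟩
  - i ℤ.+ j       ≡⟨ ℤ.+-comm (- i) j ⟩
  j - i           ∎
  where open ≡-Reasoning

module _ {n m : ℕ} where

  unprimed-++ : (xs ys : List (Idx n m)) → unprimed (xs ++ ys) ≡ unprimed xs ++ unprimed ys
  unprimed-++ []            ys = refl
  unprimed-++ (inj₁ i ∷ xs) ys = cong (i ∷_) (unprimed-++ xs ys)
  unprimed-++ (inj₂ _ ∷ xs) ys = unprimed-++ xs ys

  primed-++ : (xs ys : List (Idx n m)) → primed (xs ++ ys) ≡ primed xs ++ primed ys
  primed-++ []            ys = refl
  primed-++ (inj₁ _ ∷ xs) ys = primed-++ xs ys
  primed-++ (inj₂ j ∷ xs) ys = cong (j ∷_) (primed-++ xs ys)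

  length-primed-++ : (xs ys : List (Idx n m)) →
                     length (primed (xs ++ ys)) ≡ length (primed xs) + length (primed ys)
  length-primed-++ xs ys = trans (cong length (primed-++ xs ys)) (length-++ (primed xs))

  rightStepsBefore-self : (i : Fin n) (xs : List (Idx n m)) → rightStepsBefore i (inj₁ i ∷ xs) ≡ 0
  rightStepsBefore-self i xs with i ≟ i
  ... | yes _  = refl
  ... | no i≢i = ⊥-elim (i≢i refl)

  rightStepsBefore-++-∈ : (i : Fin n) (xs ys : List (Idx n m)) → i ∈ unprimed xs →
                          rightStepsBefore i (xs ++ ys) ≡ rightStepsBefore i xs
  rightStepsBefore-++-∈ i (inj₁ j ∷ xs) ys i∈ with j ≟ i | i∈
  ... | yes _  | _         = refl
  ... | no j≢i | here i≡j  = ⊥-elim (j≢i (sym i≡j))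
  ... | no _   | there i∈′ = rightStepsBefore-++-∈ i xs ys i∈′
  rightStepsBefore-++-∈ i (inj₂ _ ∷ xs) ys i∈ = cong suc (rightStepsBefore-++-∈ i xs ys i∈)

  rightStepsBefore-++-∉ : (i : Fin n) (xs ys : List (Idx n m)) → i ∉ unprimed xs →
                          rightStepsBefore i (xs ++ ys) ≡ length (primed xs) + rightStepsBefore i ys
  rightStepsBefore-++-∉ i []            ys i∉ = refl
  rightStepsBefore-++-∉ i (inj₁ j ∷ xs) ys i∉ with j ≟ i
  ... | yes j≡i = ⊥-elim (i∉ (here (sym j≡i)))
  ... | no  _   = rightStepsBefore-++-∉ i xs ys (i∉ ∘ there)
  rightStepsBefore-++-∉ i (inj₂ _ ∷ xs) ys i∉ = cong suc (rightStepsBefore-++-∉ i xs ys i∉)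

  rightStepsBefore-≤ : (i : Fin n) (xs : List (Idx n m)) → rightStepsBefore i xs ≤ length (primed xs)
  rightStepsBefore-≤ i []            = z≤n
  rightStepsBefore-≤ i (inj₁ j ∷ xs) with j ≟ i
  ... | yes _ = z≤n
  ... | no  _ = rightStepsBefore-≤ i xs
  rightStepsBefore-≤ i (inj₂ _ ∷ xs) = s≤s (rightStepsBefore-≤ i xs)

  rightStepsBefore-last⇔ : {i : Fin n} {ys : List (Fin n)} {w xs : List (Idx n m)} {x : Idx n m} →
                           w ≡ xs ∷ʳ x → unprimed w ≡ ys ∷ʳ i → i ∉ ys →
                           (rightStepsBefore i w ≡ length (primed w)) ⇔ (x ≡ inj₁ i)
  rightStepsBefore-last⇔ {ys = ys} {xs = xs} {inj₁ j} refl up i∉ys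
    with ∷ʳ-injective (unprimed xs) ys (trans (sym (unprimed-++ xs [ inj₁ j ])) up)
  ... | xs≡ys , refl = mk⇔ (λ _ → refl) (λ _ → full)
    where
    open ≡-Reasoning
    full : rightStepsBefore j (xs ∷ʳ inj₁ j) ≡ length (primed (xs ∷ʳ inj₁ j))
    full = begin
      rightStepsBefore j (xs ++ [ inj₁ j ])             ≡⟨ rightStepsBefore-++-∉ j xs _ (subst (j ∉_) (sym xs≡ys) i∉ys) ⟩
      length (primed xs) + rightStepsBefore j [ inj₁ j ] ≡⟨ cong (length (primed xs) +_) (rightStepsBefore-self j []) ⟩
      length (primed xs) + 0                            ≡⟨ length-primed-++ xs [ inj₁ j ] ⟨
      length (primed (xs ∷ʳ inj₁ j))                    ∎
  rightStepsBefore-last⇔ {i} {ys} {xs = xs} {inj₂ j} refl up _ = mk⇔ (⊥-elim ∘ not-full) (λ ())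
    where
    unprimed-xs : unprimed xs ≡ ys ∷ʳ i
    unprimed-xs = trans (sym (++-identityʳ (unprimed xs))) (trans (sym (unprimed-++ xs [ inj₂ j ])) up)
    not-full : rightStepsBefore i (xs ∷ʳ inj₂ j) ≢ length (primed (xs ∷ʳ inj₂ j))
    not-full eq = <-irrefl eq (begin-strict
      rightStepsBefore i (xs ∷ʳ inj₂ j) ≡⟨ rightStepsBefore-++-∈ i xs _ (subst (i ∈_) (sym unprimed-xs) (∈-++⁺ʳ ys (here refl))) ⟩
      rightStepsBefore i xs             ≤⟨ rightStepsBefore-≤ i xs ⟩
      length (primed xs)                <⟨ n<1+n _ ⟩
      suc (length (primed xs))          ≡⟨ +-comm 1 _ ⟩
      length (primed xs) + 1            ≡⟨ length-primed-++ xs [ inj₂ j ] ⟨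
      length (primed (xs ∷ʳ inj₂ j))    ∎)
      where open ≤-Reasoning

  0<rightStepsBefore⇒head-primed : {i : Fin n} {j : Fin m} {is : List (Fin n)} {js : List (Fin m)}
                                   (x : Idx n m) (w : List (Idx n m)) →
                                   unprimed (x ∷ w) ≡ i ∷ is → primed (x ∷ w) ≡ j ∷ js →
                                   0 < rightStepsBefore i (x ∷ w) → x ≡ inj₂ j
  0<rightStepsBefore⇒head-primed (inj₁ i) w refl _    pos = ⊥-elim (<-irrefl (sym (rightStepsBefore-self i w)) pos)
  0<rightStepsBefore⇒head-primed (inj₂ j) w _    refl _   = refl

  head-primed⇒0<rightStepsBefore : {i : Fin n} {j : Fin m} {x : Idx n m} (w : List (Idx n m)) →
                                   x ≡ inj₂ j → 0 < rightStepsBefore i (x ∷ w)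
  head-primed⇒0<rightStepsBefore w refl = s≤s z≤n

oneLine-∷ʳ : ∀ {n m} (f : Idx n (suc m) → Idx n (suc m)) → ∃ λ xs → oneLine f ≡ xs ∷ʳ f (inj₂ (fromℕ m))
oneLine-∷ʳ {n} {m} f = map f (U ++ map inj₂ T) , (begin
  map f (U ++ map inj₂ (allFin (suc m)))         ≡⟨ cong (λ l → map f (U ++ map inj₂ l)) (allFin-∷ʳ m) ⟩
  map f (U ++ map inj₂ (T ∷ʳ fromℕ m))          ≡⟨ cong (λ l → map f (U ++ l)) (map-++ inj₂ T _) ⟩
  map f (U ++ (map inj₂ T ∷ʳ inj₂ (fromℕ m)))    ≡⟨ cong (map f) (++-assoc U (map inj₂ T) _) ⟨
  map f ((U ++ map inj₂ T) ∷ʳ inj₂ (fromℕ m))    ≡⟨ map-++ f (U ++ map inj₂ T) _ ⟩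
  map f (U ++ map inj₂ T) ∷ʳ f (inj₂ (fromℕ m))  ∎)
  where
  open ≡-Reasoning
  U : List (Idx n (suc m))
  U = map inj₁ (allFin n)
  T : List (Fin (suc m))
  T = tabulate inject₁

bits-minus≡1 : {x y : ℤ} → x ≡ 0ℤ ⊎ x ≡ 1ℤ → y ≡ 0ℤ ⊎ y ≡ 1ℤ → x - y ≡ 1ℤ → x ≡ 1ℤ
bits-minus≡1 (inj₂ x≡1)  _           _  = x≡1
bits-minus≡1 (inj₁ refl) (inj₁ refl) ()
bits-minus≡1 (inj₁ refl) (inj₂ refl) ()

bits-minus≡-1 : {x y : ℤ} → x ≡ 0ℤ ⊎ x ≡ 1ℤ → y ≡ 0ℤ ⊎ y ≡ 1ℤ → x - y ≡ - 1ℤ → y ≡ 1ℤ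
bits-minus≡-1 _           (inj₂ y≡1)  _  = y≡1
bits-minus≡-1 (inj₁ refl) (inj₁ refl) ()
bits-minus≡-1 (inj₂ refl) (inj₁ refl) ()

module _ {n m : ℕ} where

  ε-self : (a : Idx n m) → ε a a ≡ 1ℤ
  ε-self (inj₁ i) with i ≟ i
  ... | yes _  = refl
  ... | no i≢i = ⊥-elim (i≢i refl)
  ε-self (inj₂ j) with j ≟ j
  ... | yes _  = refl
  ... | no j≢j = ⊥-elim (j≢j refl)

  ε-≢ : {a b : Idx n m} → a ≢ b → ε a b ≡ 0ℤ
  ε-≢ {inj₁ i} {inj₁ k} a≢b with i ≟ k
  ... | yes i≡k = ⊥-elim (a≢b (cong inj₁ i≡k))
  ... | no  _   = refl
  ε-≢ {inj₁ _} {inj₂ _} _ = refl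
  ε-≢ {inj₂ _} {inj₁ _} _ = refl
  ε-≢ {inj₂ j} {inj₂ k} a≢b with j ≟ k
  ... | yes j≡k = ⊥-elim (a≢b (cong inj₂ j≡k))
  ... | no  _   = refl

  ε≡1⇒≡ : (a b : Idx n m) → ε a b ≡ 1ℤ → a ≡ b
  ε≡1⇒≡ a b εab≡1 with ≡-dec _≟_ _≟_ a b
  ... | yes a≡b = a≡b
  ... | no  a≢b = ⊥-elim (0≢1 (trans (sym (ε-≢ a≢b)) εab≡1))
    where
    0≢1 : 0ℤ ≢ 1ℤ
    0≢1 ()

  ε-bit : (a b : Idx n m) → ε a b ≡ 0ℤ ⊎ ε a b ≡ 1ℤ
  ε-bit a b with ≡-dec _≟_ _≟_ a b
  ... | yes refl = inj₂ (ε-self a)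
  ... | no  a≢b  = inj₁ (ε-≢ a≢b)

  ε-difference-injective : {a b c d : Idx n m} → a ≢ b → (ε a −ʷ ε b) ≗ʷ (ε c −ʷ ε d) → c ≡ a × d ≡ b
  ε-difference-injective {a} {b} {c} {d} a≢b h =
    ε≡1⇒≡ c a (bits-minus≡1 (ε-bit c a) (ε-bit d a) at-a) , ε≡1⇒≡ d b (bits-minus≡-1 (ε-bit c b) (ε-bit d b) at-b)
    where
    at-a : ε c a - ε d a ≡ 1ℤ
    at-a = trans (sym (h a)) (cong₂ _-_ (ε-self a) (ε-≢ (a≢b ∘ sym)))
    at-b : ε c b - ε d b ≡ - 1ℤ
    at-b = trans (sym (h b)) (cong₂ _-_ (ε-≢ a≢b) (ε-self b))

  negʷ-ε-difference⇔ : {a b c d : Idx n m} → a ≢ b → (negʷ (ε a −ʷ ε b) ≗ʷ (ε c −ʷ ε d)) ⇔ (c ≡ b × d ≡ a)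
  negʷ-ε-difference⇔ {a} {b} a≢b = mk⇔
    (λ h → ε-difference-injective {a = b} {b = a} (a≢b ∘ sym) (λ i → trans (sym (neg-minus (ε a i) (ε b i))) (h i)))
    (λ { (refl , refl) i → neg-minus (ε a i) (ε b i) })

hook-⊆ₚ⇔ : ∀ {n} m (λ′ : Partition (suc n)) →
           (hook (suc n) (suc m) ⊆ₚ λ′) ⇔ ((∀ k → 0 < λ′ k) × suc m ≤ λ′ zero)
hook-⊆ₚ⇔ {n} m λ′ = mk⇔ to from
  where
  to : hook (suc n) (suc m) ⊆ₚ λ′ → (∀ k → 0 < λ′ k) × suc m ≤ λ′ zero
  to H = (λ k → parts k 0 (hook-pos k)) , parts zero m (n<1+n m)
    where
    parts : ∀ k c → c < hook (suc n) (suc m) k → c < λ′ k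
    parts k c = subst (λ k′ → c < hook (suc n) (suc m) k′ → c < λ′ k′) (opposite-involutive k) (H (opposite k) c)
    hook-pos : ∀ k → 0 < hook (suc n) (suc m) k
    hook-pos zero    = s≤s z≤n
    hook-pos (suc _) = s≤s z≤n
  from : (∀ k → 0 < λ′ k) × suc m ≤ λ′ zero → hook (suc n) (suc m) ⊆ₚ λ′
  from (nonempty , full) r = parts (opposite r)
    where
    parts : ∀ k c → c < hook (suc n) (suc m) k → c < λ′ k
    parts zero    c       c<m      = ≤-trans c<m full
    parts (suc k) zero    _        = nonempty (suc k)
    parts (suc k) (suc c) (s≤s ())

module _ {n m : ℕ} (s : Shuffle (suc n) (suc m)) where

  length-primed-oneLine : length (primed (oneLine (σ s))) ≡ suc m
  length-primed-oneLine = trans (cong length (primedOrd s)) (length-tabulate (λ j → j))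

  rowLength-≤ : ∀ r → rowLength s r ≤ suc m
  rowLength-≤ r = ≤-trans (rightStepsBefore-≤ r (oneLine (σ s))) (≤-reflexive length-primed-oneLine)

  lastRow-full⇔ : (rowLength s (fromℕ n) ≡ suc m) ⇔ (σ s (inj₂ (fromℕ m)) ≡ inj₁ (fromℕ n))
  lastRow-full⇔ with xs , oneLine≡ ← oneLine-∷ʳ (σ s) =
    subst (λ k → (rowLength s (fromℕ n) ≡ k) ⇔ (σ s (inj₂ (fromℕ m)) ≡ inj₁ (fromℕ n))) length-primed-oneLine
          (rightStepsBefore-last⇔ oneLine≡ (trans (unprimedOrd s) (allFin-∷ʳ n)) (fromℕ∉tabulate-inject₁ n))

  firstRow-nonempty⇒ : 0 < rowLength s zero → σ s (inj₁ zero) ≡ inj₂ zero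
  firstRow-nonempty⇒ = 0<rightStepsBefore⇒head-primed (σ s (inj₁ zero)) _ (unprimedOrd s) (primedOrd s)

  first-primed⇒rows-nonempty : ∀ {j} → σ s (inj₁ zero) ≡ inj₂ j → ∀ r → 0 < rowLength s r
  first-primed⇒rows-nonempty eq r = head-primed⇒0<rightStepsBefore _ eq

  hook-⊆ₚ-ζ⇔ : (hook (suc n) (suc m) ⊆ₚ ζ s) ⇔
               ((σ s (inj₁ zero) ≡ inj₂ zero) × (σ s (inj₂ (fromℕ m)) ≡ inj₁ (fromℕ n)))
  hook-⊆ₚ-ζ⇔ = (rows-nonempty⇔ ×-⇔ (lastRow-full⇔ ⇔-∘ lastRow-≥⇔)) ⇔-∘ hook-⊆ₚ⇔ m (ζ s)
    where
    rows-nonempty⇔ : (∀ k → 0 < ζ s k) ⇔ (σ s (inj₁ zero) ≡ inj₂ zero)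
    rows-nonempty⇔ = mk⇔
      (λ nonempty → firstRow-nonempty⇒ (subst (λ r → 0 < rowLength s r) (opposite-involutive zero) (nonempty (fromℕ n))))
      (λ first-primed k → first-primed⇒rows-nonempty first-primed (opposite k))
    lastRow-≥⇔ : (suc m ≤ ζ s zero) ⇔ (rowLength s (fromℕ n) ≡ suc m)
    lastRow-≥⇔ = mk⇔ (≤-antisym (rowLength-≤ (fromℕ n))) (≤-reflexive ∘ sym)

lemma2p4 : (n m : ℕ) (pn : 0 < n) (nm : n < m) (s : Shuffle n m) →
  ((hook n m ⊆ₚ ζ s) ⇔ (negʷ (ε (inj₁ (lastFin pn)) −ʷ ε (inj₂ (firstFin (<-trans pn nm)))) ≗ʷ highestRoot pn (<-trans pn nm) s))
  × ((ζ s (firstFin pn) ≡ m) ⇔ (σ s (inj₂ (lastFin (<-trans pn nm))) ≡ inj₁ (lastFin pn)))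
  × ((hook n m ⊆ₚ ζ s) ⇔ ((σ s (inj₁ (firstFin pn)) ≡ inj₂ (firstFin (<-trans pn nm))) × (σ s (inj₂ (lastFin (<-trans pn nm))) ≡ inj₁ (lastFin pn))))
lemma2p4 zero    _       () _  _
lemma2p4 (suc _) zero    _  () _
lemma2p4 (suc n) (suc m) _  _  s =
    ⇔-sym (negʷ-ε-difference⇔ (λ ())) ⇔-∘ hook-⊆ₚ-ζ⇔ s
  , lastRow-full⇔ s
  , hook-⊆ₚ-ζ⇔ s
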